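{- Let $n\ge1$ and $\pi \in \mathcal I^C_{2n}(321)$. Then $$\mathrm{des}(\pi)=\begin{cases} 2\,\mathrm{des}^+(\pi)-1 & \text{if } n\in E_{\pi}, \\ 2\,\mathrm{des}^+(\pi) & \text{otherwise.} \end{cases}$$
   Context: A permutation $\pi\in\mathcal S_m$ is centrosymmetric if $\pi(i)+\pi(m+1-i)=m+1$ for all $1\le i\le m$. $\mathcal I^C_m(321)$ denotes the set of centrosymmetric involutions in $\mathcal S_m$ that avoid the pattern $321$. $\mathrm{des}(\pi)$ is the number of $i\in\{1,\dots,2n-1\}$ with $\pi(i)>\pi(i+1)$, and $\mathrm{des}^+(\pi)$ is the number of such $i$ in $\{1,\dots,n\}$. $E_\pi=\{i\in\{1,\dots,n\}:\pi(i)>i\}$. -}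

module Defs where

open import Data.Nat using (ℕ; zero; suc; _+_; _*_; _∸_; _<_; _<?_)
open import Data.Fin using (Fin; toℕ; fromℕ<)
open import Data.List using (List; length; filter)
open import Data.List.Base using (upTo)
open import Data.Product using (_×_)
open import Relation.Nullary using (¬_)
open import Relation.Binary.PropositionalEquality using (_≡_)

-- Positions and values of a permutation in S_m are 1-based in the paper;
-- here π : Fin m → Fin m, and the 1-based value at 1-based position i
-- is  suc (toℕ (π (i-1))).

-- 1-based value of π at 1-based position i (0 if i out of range).
val : {m : ℕ} → (Fin m → Fin m) → ℕ → ℕ
val {m} π zero = 0
val {m} π (suc j) with j <? m
... | Relation.Nullary.yes j<m = suc (toℕ (π (fromℕ< j<m)))
... | Relation.Nullary.no _ = 0

-- π is an involution (hence a permutation of Fin m)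
IsInvolution : {m : ℕ} → (Fin m → Fin m) → Set
IsInvolution π = ∀ i → π (π i) ≡ i

IsCentrosymmetric : {m : ℕ} → (Fin m → Fin m) → Set
IsCentrosymmetric {m} π =
  ∀ i → suc i Data.Nat.≤ m → val π (suc i) + val π (m ∸ i) ≡ suc m

Avoids321 : {m : ℕ} → (Fin m → Fin m) → Set
Avoids321 {m} π = ∀ (i j k : Fin m) → toℕ i < toℕ j → toℕ j < toℕ k →
  ¬ (toℕ (π j) < toℕ (π i) × toℕ (π k) < toℕ (π j))

InICm321 : (m : ℕ) → (Fin m → Fin m) → Set
InICm321 m π = IsInvolution π × IsCentrosymmetric π × Avoids321 π

positions : ℕ → List ℕ
positions k = Data.List.map suc (upTo k)

isDescent? : {m : ℕ} → (π : Fin m → Fin m) → (i : ℕ) → Relation.Nullary.Dec (val π (suc i) < val π i)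
isDescent? π i = val π (suc i) <? val π i

des : (n : ℕ) → (Fin (2 * n) → Fin (2 * n)) → ℕ
des n π = length (filter (isDescent? π) (positions (2 * n ∸ 1)))

desPlus : (n : ℕ) → (Fin (2 * n) → Fin (2 * n)) → ℕ
desPlus n π = length (filter (isDescent? π) (positions n))

InE : (n : ℕ) → (Fin (2 * n) → Fin (2 * n)) → ℕ → Set
InE n π i = (1 Data.Nat.≤ i) × (i Data.Nat.≤ n) × (i < val π i)

module Submission where

-- A centrosymmetric π satisfies π(p) + π(q) = 2n + 1 whenever p + q = 2n + 1.
-- Hence p is a descent iff 2n − p is one, so the descents in {n+1,…,2n−1}
-- mirror those in {1,…,n−1}, and des π = des⁺ π + #{descents in 1..n−1}.
-- The middle position n is a descent iff π(n) > π(n+1) = 2n + 1 − π(n), i.e.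
-- iff π(n) > n.

open import Defs
open import Data.Nat using (ℕ; zero; suc; _*_; _+_; _∸_; _≤_; _<_; s≤s)
open import Data.Nat.Properties
open import Data.Fin using (Fin)
open import Data.List using (length; filter; map; upTo; _++_; [_])
open import Data.List.Properties using (length-++; filter-++; filter-accept; filter-reject; map-++; upTo-∷ʳ)
open import Data.Product using (_×_; _,_)
open import Function using (_∘_; _⇔_; mk⇔; Equivalence)
open import Relation.Nullary using (¬_; yes; no)
open import Relation.Unary using (Pred; Decidable)
open import Relation.Binary.PropositionalEquality using (_≡_; refl; sym; trans; cong; subst; module ≡-Reasoning)

private
  variable
    P : Pred ℕ _

countUpTo : Decidable P → ℕ → ℕ
countUpTo P? k = length (filter P? (positions k))

positions-suc : ∀ k → positions (suc k) ≡ positions k ++ [ suc k ]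
positions-suc k = trans (cong (map suc) (sym (upTo-∷ʳ k))) (map-++ suc (upTo k) [ k ])

countUpTo-suc : (P? : Decidable P) → ∀ k →
  countUpTo P? (suc k) ≡ countUpTo P? k + length (filter P? [ suc k ])
countUpTo-suc P? k = begin
  length (filter P? (positions (suc k)))                    ≡⟨ cong (length ∘ filter P?) (positions-suc k) ⟩
  length (filter P? (positions k ++ [ suc k ]))             ≡⟨ cong length (filter-++ P? (positions k) _) ⟩
  length (filter P? (positions k) ++ filter P? [ suc k ])  ≡⟨ length-++ (filter P? (positions k)) ⟩
  countUpTo P? k + length (filter P? [ suc k ])            ∎
  where open ≡-Reasoning

countUpTo-accept : (P? : Decidable P) → ∀ {k} → P (suc k) → countUpTo P? (suc k) ≡ suc (countUpTo P? k)
countUpTo-accept P? {k} p =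
  trans (countUpTo-suc P? k) (trans (cong ((countUpTo P? k +_) ∘ length) (filter-accept P? p)) (+-comm _ 1))

countUpTo-reject : (P? : Decidable P) → ∀ {k} → ¬ P (suc k) → countUpTo P? (suc k) ≡ countUpTo P? k
countUpTo-reject P? {k} ¬p =
  trans (countUpTo-suc P? k) (trans (cong ((countUpTo P? k +_) ∘ length) (filter-reject P? ¬p)) (+-identityʳ _))

-- If P is invariant under the reflection p ↦ m + 1 − p of {1,…,m}, the
-- positions in (a, m] are the mirror images of those in [1, b].
countUpTo-mirror : (P? : Decidable P) → ∀ m →
  (∀ i j → suc i + suc j ≡ suc m → P (suc i) → P (suc j)) →
  ∀ a b → a + b ≡ m → countUpTo P? a + countUpTo P? b ≡ countUpTo P? m
countUpTo-mirror P? m mirror a zero a+0≡m = trans (+-identityʳ _) (cong (countUpTo P?) (trans (sym (+-identityʳ a)) a+0≡m))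
countUpTo-mirror P? m mirror a (suc b) a+1+b≡m
  with P? (suc a) | countUpTo-mirror P? m mirror (suc a) b (trans (sym (+-suc a b)) a+1+b≡m)
... | yes pa | ih = begin
  countUpTo P? a + countUpTo P? (suc b)      ≡⟨ cong (countUpTo P? a +_) (countUpTo-accept P? (mirror a b ends pa)) ⟩
  countUpTo P? a + suc (countUpTo P? b)      ≡⟨ +-suc _ _ ⟩
  suc (countUpTo P? a) + countUpTo P? b      ≡⟨ cong (_+ countUpTo P? b) (countUpTo-accept P? pa) ⟨
  countUpTo P? (suc a) + countUpTo P? b      ≡⟨ ih ⟩
  countUpTo P? m                             ∎
  where
  open ≡-Reasoning
  ends : suc a + suc b ≡ suc m
  ends = cong suc a+1+b≡m
... | no ¬pa | ih = begin
  countUpTo P? a + countUpTo P? (suc b)      ≡⟨ cong (countUpTo P? a +_) (countUpTo-reject P? (¬pa ∘ mirror b a ends)) ⟩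
  countUpTo P? a + countUpTo P? b            ≡⟨ cong (_+ countUpTo P? b) (countUpTo-reject P? ¬pa) ⟨
  countUpTo P? (suc a) + countUpTo P? b      ≡⟨ ih ⟩
  countUpTo P? m                             ∎
  where
  open ≡-Reasoning
  ends : suc b + suc a ≡ suc m
  ends = trans (+-comm (suc b) (suc a)) (cong suc a+1+b≡m)

double : ∀ n → 2 * n ≡ n + n
double n = cong (n +_) (+-identityʳ n)

double-suc : ∀ n → 2 * suc n ≡ suc (suc n + n)
double-suc n = trans (double (suc n)) (+-suc (suc n) n)

<-mirror : ∀ {a a′ b b′} → a′ < a → a + b′ ≡ a′ + b → b′ < b
<-mirror {a} {a′} {b} {b′} a′<a a+b′≡a′+b = +-cancelˡ-< a b′ b (begin-strict
  a + b′   ≡⟨ a+b′≡a′+b ⟩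
  a′ + b   <⟨ +-monoˡ-< b a′<a ⟩
  a + b    ∎)
  where open ≤-Reasoning

larger-of-pair : ∀ {n x y} → x + y ≡ suc (n + n) → y < x ⇔ n < x
larger-of-pair {n} {x} {y} x+y≡1+2n = mk⇔ y<x⇒n<x n<x⇒y<x
  where
  y<x⇒n<x : y < x → n < x
  y<x⇒n<x y<x = ≰⇒> λ x≤n →
    <-irrefl x+y≡1+2n (s≤s (+-mono-≤ x≤n (<⇒≤ (<-≤-trans y<x x≤n))))
  n<x⇒y<x : n < x → y < x
  n<x⇒y<x n<x = ≰⇒> λ x≤y →
    <-irrefl (sym x+y≡1+2n) (subst (_≤ x + y) (+-suc (suc n) n) (+-mono-≤ n<x (≤-trans n<x x≤y)))

module _ {M : ℕ} {π : Fin M → Fin M} (centro : IsCentrosymmetric π) where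

  centro-sum : ∀ i j → suc i + suc j ≡ suc M → val π (suc i) + val π (suc j) ≡ suc M
  centro-sum i j i+j+2≡M+1 = subst (λ q → val π (suc i) + val π q ≡ suc M) M∸i≡1+j (centro i i<M)
    where
    i+1+j≡M : i + suc j ≡ M
    i+1+j≡M = suc-injective i+j+2≡M+1
    M∸i≡1+j : M ∸ i ≡ suc j
    M∸i≡1+j = trans (cong (_∸ i) (sym i+1+j≡M)) (m+n∸m≡n i (suc j))
    i<M : suc i ≤ M
    i<M = subst (suc i ≤_) i+1+j≡M (subst (suc i ≤_) (sym (+-suc i j)) (s≤s (m≤m+n i j)))

  descent-mirror : ∀ i j → suc i + suc j ≡ M →
    val π (suc (suc i)) < val π (suc i) → val π (suc (suc j)) < val π (suc j)
  descent-mirror i j i+j+2≡M descent = <-mirror descent (trans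
    (centro-sum i (suc j) (trans (+-suc (suc i) (suc j)) (cong suc i+j+2≡M)))
    (sym (centro-sum (suc i) j (cong suc i+j+2≡M))))

middle-descent⇔ : ∀ m {π : Fin (2 * suc m) → Fin (2 * suc m)} → IsCentrosymmetric π →
  val π (suc (suc m)) < val π (suc m) ⇔ suc m < val π (suc m)
middle-descent⇔ m centro =
  larger-of-pair (trans (centro-sum centro m (suc m) middle-pair) (cong suc (double (suc m))))
  where
  middle-pair : suc m + suc (suc m) ≡ suc (2 * suc m)
  middle-pair = trans (+-suc (suc m) (suc m)) (cong suc (sym (double (suc m))))

des≡desPlus+countUpTo : ∀ m {π : Fin (2 * suc m) → Fin (2 * suc m)} → IsCentrosymmetric π →
  des (suc m) π ≡ desPlus (suc m) π + countUpTo (isDescent? π) m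
des≡desPlus+countUpTo m {π} centro =
  trans (cong (λ k → countUpTo (isDescent? π) (k ∸ 1)) (double-suc m))
    (sym (countUpTo-mirror (isDescent? π) (suc m + m)
      (λ i j e → descent-mirror centro i j (trans e (sym (double-suc m)))) (suc m) m refl))

lemma3p9 : (n : ℕ) → 1 ≤ n → (π : Fin (2 * n) → Fin (2 * n)) → InICm321 (2 * n) π →
    (InE n π n → des n π ≡ 2 * desPlus n π ∸ 1) ×
    (¬ InE n π n → des n π ≡ 2 * desPlus n π)
lemma3p9 n@(suc m) 1≤n π (_ , centro , _) = middle-in-E , middle-not-in-E
  where
  open ≡-Reasoning
  c = countUpTo (isDescent? π) m
  middle-in-E : InE n π n → des n π ≡ 2 * desPlus n π ∸ 1
  middle-in-E (_ , _ , n<πn) = begin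
    des n π                   ≡⟨ des≡desPlus+countUpTo m centro ⟩
    desPlus n π + c           ≡⟨ cong (_+ c) des⁺≡1+c ⟩
    suc c + c                 ≡⟨ cong (_∸ 1) (double-suc c) ⟨
    2 * suc c ∸ 1             ≡⟨ cong (λ k → 2 * k ∸ 1) des⁺≡1+c ⟨
    2 * desPlus n π ∸ 1       ∎
    where
    des⁺≡1+c : desPlus n π ≡ suc c
    des⁺≡1+c = countUpTo-accept (isDescent? π) (Equivalence.from (middle-descent⇔ m centro) n<πn)
  middle-not-in-E : ¬ InE n π n → des n π ≡ 2 * desPlus n π
  middle-not-in-E n∉E = begin
    des n π                   ≡⟨ des≡desPlus+countUpTo m centro ⟩
    desPlus n π + c           ≡⟨ cong (desPlus n π +_) des⁺≡c ⟨
    desPlus n π + desPlus n π ≡⟨ double (desPlus n π) ⟨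
    2 * desPlus n π           ∎
    where
    des⁺≡c : desPlus n π ≡ c
    des⁺≡c = countUpTo-reject (isDescent? π)
      (λ descent → n∉E (1≤n , ≤-refl , Equivalence.to (middle-descent⇔ m centro) descent))
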